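{- Let $p$ be a prime, $m\geq1$ and $n\ge 1$ integers, $\mathbf{X}\in\mathbb{Z}^{n\times n}$ and $b\in\mathbb{Z}^n$ with $b\not\equiv0\bmod p$, and let $R:=\mathbb{Z}/p^m\mathbb{Z}$. For $1\le t\le n$ define $$U_t:=\sup\{j\geq0:\ \mathbf{X}^{t-1}b\in\operatorname{span}_{\mathbb{Z}}(\mathbf{X}^{i-1}b:1\leq i\leq t-1)+p^j\mathbb{Z}^n\}\in\{0,1,2,\ldots\}\cup\{\infty\}$$ and $\Lambda_t:=\min\{U_t,m\}$. Then there exist $v_1,\ldots,v_n\in R^n$ such that for every $t\leq n$: (i) the reduction modulo $p$ of the matrix $(v_1,\ldots,v_t)$ has rank $t$ over $\mathbb{F}_p$; (ii) $\operatorname{span}_R(\mathbf{X}^{i-1}b\bmod p^m:1\leq i\leq t)=\operatorname{span}_R(p^{\Lambda_i}v_i:1\leq i\leq t)$.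
   Context: For a ring $R$ and $v_1,\ldots,v_t\in R^n$, $\operatorname{span}_R(v_1,\ldots,v_t):=\{\sum_{i=1}^t c_iv_i: c_i\in R\}$; the span of an empty family is $\{0\}$. -}

module Defs where

open import Data.Nat as ℕ using (ℕ; zero; suc; _≤_; _<_)
open import Data.Integer as ℤ using (ℤ; +_; _+_; _*_; _-_)
open import Data.Integer.Divisibility using (_∣_)
open import Data.Fin using (Fin; toℕ; inject≤)
open import Data.Product using (Σ; ∃; _×_)
open import Relation.Binary.PropositionalEquality using (_≡_)

-- Vectors in ℤ^n (or representatives of elements of (ℤ/Nℤ)^n) and
-- n×n integer matrices, as functions.
Vecℤ : ℕ → Set
Vecℤ n = Fin n → ℤ

Matℤ : ℕ → Set
Matℤ n = Fin n → Fin n → ℤ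

sumFin : (t : ℕ) → (Fin t → ℤ) → ℤ
sumFin zero    f = + 0
sumFin (suc t) f = f Fin.zero + sumFin t (λ i → f (Fin.suc i))
  where import Data.Fin as Fin

_·_ : ∀ {n} → Matℤ n → Vecℤ n → Vecℤ n
_·_ {n} X w r = sumFin n (λ s → X r s * w s)

Xpow : ∀ {n} → Matℤ n → Vecℤ n → ℕ → Vecℤ n
Xpow X b zero    = b
Xpow X b (suc k) = X · Xpow X b k

_≡[mod_]_ : ∀ {n} → Vecℤ n → ℤ → Vecℤ n → Set
_≡[mod_]_ w N u = ∀ r → N ∣ (w r - u r)

lincomb : ∀ {n t} → (Fin t → ℤ) → (Fin t → Vecℤ n) → Vecℤ n
lincomb {t = t} c u r = sumFin t (λ i → c i * u i r)

-- w ∈ span_{ℤ/Nℤ}(u_1,…,u_t)  (everything via integer representatives)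
InSpanMod : ∀ {n t} → ℤ → Vecℤ n → (Fin t → Vecℤ n) → Set
InSpanMod {t = t} N w u = ∃ λ (c : Fin t → ℤ) → w ≡[mod N ] lincomb c u

SpanEqMod : ∀ {n t s} → ℤ → (Fin t → Vecℤ n) → (Fin s → Vecℤ n) → Set
SpanEqMod {n} N u u' =
  ∀ (w : Vecℤ n) → (InSpanMod N w u → InSpanMod N w u') × (InSpanMod N w u' → InSpanMod N w u)

-- The n×t matrix (u_1,…,u_t) reduced mod p has rank t over F_p, i.e. its
-- t columns are linearly independent over F_p.
FullColumnRankModp : ∀ {n t} → ℕ → (Fin t → Vecℤ n) → Set
FullColumnRankModp {t = t} p u =
  ∀ (c : Fin t → ℤ) → (∀ r → (+ p) ∣ lincomb c u r) → ∀ i → (+ p) ∣ c i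

-- For t = k+1 (k = toℕ of the 0-based index):
-- X^{t-1} b ∈ span_ℤ(X^{i-1} b : 1 ≤ i ≤ t-1) + p^j ℤ^n
UPred : ∀ {n} → ℕ → Matℤ n → Vecℤ n → ℕ → ℕ → Set
UPred {n} p X b k j =
  ∃ λ (c : Fin k → ℤ) → ∃ λ (e : Vecℤ n) →
    ∀ r → Xpow X b k r ≡ lincomb c (λ i → Xpow X b (toℕ i)) r + (+ (p ℕ.^ j)) * e r

-- λ = min{U, m} where U = sup{ j ≥ 0 : UPred j } ∈ ℕ ∪ {∞}:
-- λ ≤ m, λ belongs to the set (so U ≥ λ), and if λ < m then λ is an upper
-- bound of the set (so U = λ).
IsMinSupM : (ℕ → Set) → ℕ → ℕ → Set
IsMinSupM P m λ' = (λ' ≤ m) × P λ' × (λ' < m → ∀ j → P j → j ≤ λ')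

_⋆_ : ∀ {n} → ℤ → Vecℤ n → Vecℤ n
(a ⋆ w) r = a * w r

-- Write Kᵢ = Xⁱ b and Q = pᵐ. We carry a basis w of (ℤ/p)ⁿ together with a dual family φ
-- (⟨φₛ, wⱼ⟩ ≡ δₛⱼ and u ≡ Σₛ ⟨φₛ, u⟩ wₛ modulo p) and change it one vector at a time so that
-- span(Kᵢ : i < t) = span(p^Λᵢ wᵢ : i < t) modulo Q for every t up to the current step.
-- At step k, Λₖ provides K_k = Σ cᵢ Kᵢ + p^Λₖ e. As Λ is non-decreasing, p^Λₖ times the
-- component of e along w₀, …, w_{k-1} already lies in the span, leaving a residual z whose
-- coordinates below k vanish modulo p. If Λₖ = m then p^Λₖ z ≡ 0 and w is kept. Otherwise some
-- coordinate of z is a unit modulo p, because z ≡ 0 would put K_k into the span plus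
-- p^(Λₖ+1) ℤⁿ, against the maximality of Λₖ; an exchange step then makes z the new w_k.
-- Independence modulo p of every prefix of w is witnessed by the dual family.

{-# OPTIONS --safe #-}
module Submission where

open import Defs
open import Data.Nat as ℕ using (ℕ; zero; suc; _≤_; _<_; _^_; _∸_; z≤n)
import Data.Nat.Properties as ℕP
import Data.Nat.Divisibility as ℕ∣
open import Data.Nat.Primality using (Prime; prime⇒irreducible)
open import Data.Nat.Coprimality using (Coprime; coprime-Bézout)
open import Data.Nat.GCD using (module Bézout)
open import Data.Integer as ℤ using (ℤ; +_; -[1+_]; -1ℤ; _+_; _*_; _-_; -_)
import Data.Integer.Properties as ℤP
open import Data.Integer.Divisibility using (_∣_)
import Data.Integer.Divisibility.Signed as ℤ∣
open import Data.Integer.Tactic.RingSolver using (solve-∀)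
open import Data.Fin as Fin using (Fin; toℕ; inject≤; fromℕ<; _≟_)
import Data.Fin.Properties as FinP
open import Data.Vec.Functional using (updateAt; _∷_)
open import Data.Vec.Functional.Properties using (updateAt-updates; updateAt-minimal)
open import Data.Product using (∃; ∃₂; _×_; _,_; proj₁; proj₂; uncurry)
open import Function using (_∘_; _$_; const; Injective)
open import Relation.Binary.Bundles using (Setoid)
open import Relation.Binary.PropositionalEquality
open import Relation.Nullary using (¬_; yes; no)
open import Data.Empty using (⊥-elim)
open import Data.Sum using (inj₁; inj₂)

-- Finite sums and the dot product

m+n-m≡n : ∀ m n → m + n - m ≡ n
m+n-m≡n = solve-∀

m+n-n≡m : ∀ m n → m + n - n ≡ m
m+n-n≡m = solve-∀

sumFin-cong : ∀ t {f g : Fin t → ℤ} → (∀ i → f i ≡ g i) → sumFin t f ≡ sumFin t g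
sumFin-cong zero    f≗g = refl
sumFin-cong (suc t) f≗g = cong₂ _+_ (f≗g Fin.zero) (sumFin-cong t (λ i → f≗g (Fin.suc i)))

sumFin-distrib-+ : ∀ t (f g : Fin t → ℤ) → sumFin t (λ i → f i + g i) ≡ sumFin t f + sumFin t g
sumFin-distrib-+ zero    f g = refl
sumFin-distrib-+ (suc t) f g =
  trans (cong (_+_ (f Fin.zero + g Fin.zero)) (sumFin-distrib-+ t (f ∘ Fin.suc) (g ∘ Fin.suc)))
        (interchange (f Fin.zero) (g Fin.zero) _ _)
  where
  interchange : ∀ a b c d → (a + b) + (c + d) ≡ (a + c) + (b + d)
  interchange = solve-∀

*-distribˡ-sumFin : ∀ t a (f : Fin t → ℤ) → a * sumFin t f ≡ sumFin t (λ i → a * f i)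
*-distribˡ-sumFin zero    a f = ℤP.*-zeroʳ a
*-distribˡ-sumFin (suc t) a f =
  trans (ℤP.*-distribˡ-+ a _ _) (cong (_+_ (a * f Fin.zero)) (*-distribˡ-sumFin t a _))

sumFin-zero : ∀ t → sumFin t (λ _ → + 0) ≡ + 0
sumFin-zero zero    = refl
sumFin-zero (suc t) = trans (ℤP.+-identityˡ _) (sumFin-zero t)

sumFin-comm : ∀ s t (f : Fin s → Fin t → ℤ) →
  sumFin s (λ i → sumFin t (f i)) ≡ sumFin t (λ j → sumFin s (λ i → f i j))
sumFin-comm zero    t f = sym (sumFin-zero t)
sumFin-comm (suc s) t f =
  trans (cong (_+_ (sumFin t (f Fin.zero))) (sumFin-comm s t _)) (sym (sumFin-distrib-+ t _ _))

sumFin-neg : ∀ t (f : Fin t → ℤ) → sumFin t (λ i → - f i) ≡ - sumFin t f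
sumFin-neg t f = begin
  sumFin t (λ i → - f i)      ≡⟨ sumFin-cong t (λ i → ℤP.-1*i≡-i (f i)) ⟨
  sumFin t (λ i → -1ℤ * f i)  ≡⟨ *-distribˡ-sumFin t -1ℤ f ⟨
  -1ℤ * sumFin t f            ≡⟨ ℤP.-1*i≡-i (sumFin t f) ⟩
  - sumFin t f                ∎
  where open ≡-Reasoning

δ : ∀ {t} → Fin t → Fin t → ℤ
δ Fin.zero    Fin.zero    = + 1
δ Fin.zero    (Fin.suc _) = + 0
δ (Fin.suc _) Fin.zero    = + 0
δ (Fin.suc i) (Fin.suc j) = δ i j

δ-diag : ∀ {t} (i : Fin t) → δ i i ≡ + 1
δ-diag Fin.zero    = refl
δ-diag (Fin.suc i) = δ-diag i

δ-off : ∀ {t} {i j : Fin t} → i ≢ j → δ i j ≡ + 0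
δ-off {i = Fin.zero}  {Fin.zero}  i≢j = ⊥-elim (i≢j refl)
δ-off {i = Fin.zero}  {Fin.suc j} i≢j = refl
δ-off {i = Fin.suc i} {Fin.zero}  i≢j = refl
δ-off {i = Fin.suc i} {Fin.suc j} i≢j = δ-off (i≢j ∘ cong Fin.suc)

δ-sym : ∀ {t} (i j : Fin t) → δ i j ≡ δ j i
δ-sym i j with i ≟ j
... | yes refl = refl
... | no i≢j   = trans (δ-off i≢j) (sym (δ-off (i≢j ∘ sym)))

δ-injective : ∀ {s t} {f : Fin s → Fin t} → Injective _≡_ _≡_ f → ∀ i j → δ (f i) (f j) ≡ δ i j
δ-injective {f = f} f-inj i j with i ≟ j
... | yes refl = trans (δ-diag (f i)) (sym (δ-diag i))
... | no i≢j   = trans (δ-off (i≢j ∘ f-inj)) (sym (δ-off i≢j))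

toℕ-inject≤< : ∀ {n t} (i : Fin t) .(t≤n : t ≤ n) → toℕ (inject≤ i t≤n) < t
toℕ-inject≤< i t≤n = subst (_< _) (sym (FinP.toℕ-inject≤ i t≤n)) (FinP.toℕ<n i)

inject≤-toℕ-cong : ∀ {n s t} {i : Fin s} {j : Fin t} .(s≤n : s ≤ n) .(t≤n : t ≤ n) →
  toℕ i ≡ toℕ j → inject≤ i s≤n ≡ inject≤ j t≤n
inject≤-toℕ-cong {i = i} {j} s≤n t≤n i≡j =
  FinP.toℕ-injective (trans (FinP.toℕ-inject≤ i s≤n) (trans i≡j (sym (FinP.toℕ-inject≤ j t≤n))))

infix 8 ⟨_,_⟩

-- lincomb c u r is ⟨ c , (λ i → u i r) ⟩ and (X · v) r is ⟨ X r , v ⟩, definitionally.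
⟨_,_⟩ : ∀ {t} → (Fin t → ℤ) → (Fin t → ℤ) → ℤ
⟨_,_⟩ {t} f g = sumFin t (λ i → f i * g i)

δ-sift : ∀ {t} (i : Fin t) (f : Fin t → ℤ) → ⟨ δ i , f ⟩ ≡ f i
δ-sift {suc t} Fin.zero f =
  trans (cong₂ _+_ (ℤP.*-identityˡ (f Fin.zero)) (sumFin-zero t)) (ℤP.+-identityʳ (f Fin.zero))
δ-sift {suc t} (Fin.suc i) f = trans (ℤP.+-identityˡ _) (δ-sift i (f ∘ Fin.suc))

⟨⟩-comm : ∀ {t} (f g : Fin t → ℤ) → ⟨ f , g ⟩ ≡ ⟨ g , f ⟩
⟨⟩-comm f g = sumFin-cong _ (λ i → ℤP.*-comm (f i) (g i))

⟨⟩-+ʳ : ∀ {t} (f g h : Fin t → ℤ) → ⟨ f , (λ i → g i + h i) ⟩ ≡ ⟨ f , g ⟩ + ⟨ f , h ⟩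
⟨⟩-+ʳ {t} f g h =
  trans (sumFin-cong t (λ i → ℤP.*-distribˡ-+ (f i) (g i) (h i))) (sumFin-distrib-+ t _ _)

⟨⟩-+ˡ : ∀ {t} (f g h : Fin t → ℤ) → ⟨ (λ i → f i + g i) , h ⟩ ≡ ⟨ f , h ⟩ + ⟨ g , h ⟩
⟨⟩-+ˡ {t} f g h =
  trans (sumFin-cong t (λ i → ℤP.*-distribʳ-+ (h i) (f i) (g i))) (sumFin-distrib-+ t _ _)

⟨⟩-diffʳ : ∀ {t} (f g h : Fin t → ℤ) → ⟨ f , (λ i → g i - h i) ⟩ ≡ ⟨ f , g ⟩ - ⟨ f , h ⟩
⟨⟩-diffʳ {t} f g h = trans (⟨⟩-+ʳ f g (λ i → - h i))
  (cong (_+_ ⟨ f , g ⟩) (trans (sumFin-cong t (λ i → sym (ℤP.neg-distribʳ-* (f i) (h i))))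
                               (sumFin-neg t _)))

⟨⟩-diffˡ : ∀ {t} (f g h : Fin t → ℤ) → ⟨ (λ i → f i - g i) , h ⟩ ≡ ⟨ f , h ⟩ - ⟨ g , h ⟩
⟨⟩-diffˡ f g h = trans (⟨⟩-comm _ h)
  (trans (⟨⟩-diffʳ h f g) (cong₂ _-_ (⟨⟩-comm h f) (⟨⟩-comm h g)))

⟨⟩-⋆ʳ : ∀ {t} (f : Fin t → ℤ) a g → ⟨ f , a ⋆ g ⟩ ≡ a * ⟨ f , g ⟩
⟨⟩-⋆ʳ {t} f a g =
  trans (sumFin-cong t (λ i → left-comm (f i) a (g i))) (sym (*-distribˡ-sumFin t a _))
  where
  left-comm : ∀ x y z → x * (y * z) ≡ y * (x * z)
  left-comm = solve-∀

⟨⟩-lincomb : ∀ {n t} (f : Vecℤ n) (a : Fin t → ℤ) (u : Fin t → Vecℤ n) →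
  ⟨ f , lincomb a u ⟩ ≡ ⟨ a , (λ i → ⟨ f , u i ⟩) ⟩
⟨⟩-lincomb {n} {t} f a u = begin
  sumFin n (λ r → f r * sumFin t (λ i → a i * u i r))
    ≡⟨ sumFin-cong n (λ r → *-distribˡ-sumFin t (f r) _) ⟩
  sumFin n (λ r → sumFin t (λ i → f r * (a i * u i r)))
    ≡⟨ sumFin-comm n t _ ⟩
  sumFin t (λ i → sumFin n (λ r → f r * (a i * u i r)))
    ≡⟨ sumFin-cong t (λ i → ⟨⟩-⋆ʳ f (a i) (u i)) ⟩
  sumFin t (λ i → a i * ⟨ f , u i ⟩) ∎
  where open ≡-Reasoning

⟨⟩-⋆ˡ : ∀ {t} a (f g : Fin t → ℤ) → ⟨ a ⋆ f , g ⟩ ≡ a * ⟨ f , g ⟩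
⟨⟩-⋆ˡ {t} a f g =
  trans (sumFin-cong t (λ i → ℤP.*-assoc a (f i) (g i))) (sym (*-distribˡ-sumFin t a _))

⟨⟩-zeroʳ : ∀ {t} (f : Fin t → ℤ) → ⟨ f , (λ _ → + 0) ⟩ ≡ + 0
⟨⟩-zeroʳ {t} f = trans (sumFin-cong t (λ i → ℤP.*-zeroʳ (f i))) (sumFin-zero t)

-- Congruences modulo d

infix 4 _≡_[mod_]

record _≡_[mod_] (x y d : ℤ) : Set where
  constructor ≡mod
  field divides-diff : d ℤ∣.∣ x - y

open _≡_[mod_] public

module _ {d : ℤ} where

  ≡mod-reflexive : ∀ {x y} → x ≡ y → x ≡ y [mod d ]
  ≡mod-reflexive {x} refl = ≡mod (ℤ∣.divides (+ 0) (ℤP.+-inverseʳ x))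

  ≡mod-refl : ∀ {x} → x ≡ x [mod d ]
  ≡mod-refl = ≡mod-reflexive refl

  ≡mod-sym : ∀ {x y} → x ≡ y [mod d ] → y ≡ x [mod d ]
  ≡mod-sym {x} {y} (≡mod d∣x-y) = ≡mod (subst (d ℤ∣.∣_) (negate-diff x y) (ℤ∣.∣m⇒∣-m d∣x-y))
    where
    negate-diff : ∀ x y → - (x - y) ≡ y - x
    negate-diff = solve-∀

  ≡mod-trans : ∀ {x y z} → x ≡ y [mod d ] → y ≡ z [mod d ] → x ≡ z [mod d ]
  ≡mod-trans {x} {y} {z} (≡mod d∣x-y) (≡mod d∣y-z) =
    ≡mod (subst (d ℤ∣.∣_) (ℤP.+-minus-telescope x y z) (ℤ∣.∣m∣n⇒∣m+n d∣x-y d∣y-z))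

  +-cong-≡mod : ∀ {x x′ y y′} → x ≡ x′ [mod d ] → y ≡ y′ [mod d ] → x + y ≡ x′ + y′ [mod d ]
  +-cong-≡mod {x} {x′} {y} {y′} (≡mod d∣x-x′) (≡mod d∣y-y′) =
    ≡mod (subst (d ℤ∣.∣_) (regroup x x′ y y′) (ℤ∣.∣m∣n⇒∣m+n d∣x-x′ d∣y-y′))
    where
    regroup : ∀ x x′ y y′ → (x - x′) + (y - y′) ≡ (x + y) - (x′ + y′)
    regroup = solve-∀

  *-cong-≡mod : ∀ {x x′ y y′} → x ≡ x′ [mod d ] → y ≡ y′ [mod d ] → x * y ≡ x′ * y′ [mod d ]
  *-cong-≡mod {x} {x′} {y} {y′} (≡mod d∣x-x′) (≡mod d∣y-y′) =
    ≡mod (subst (d ℤ∣.∣_) (regroup x x′ y y′)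
      (ℤ∣.∣m∣n⇒∣m+n (ℤ∣.∣n⇒∣m*n x d∣y-y′) (ℤ∣.∣m⇒∣m*n y′ d∣x-x′)))
    where
    regroup : ∀ x x′ y y′ → x * (y - y′) + (x - x′) * y′ ≡ x * y - x′ * y′
    regroup = solve-∀

  -‿cong-≡mod : ∀ {x x′} → x ≡ x′ [mod d ] → - x ≡ - x′ [mod d ]
  -‿cong-≡mod {x} {x′} (≡mod d∣x-x′) =
    ≡mod (subst (d ℤ∣.∣_) (negate-diff x x′) (ℤ∣.∣m⇒∣-m d∣x-x′))
    where
    negate-diff : ∀ x x′ → - (x - x′) ≡ - x - - x′
    negate-diff = solve-∀

  sub-cong-≡mod : ∀ {x x′ y y′} → x ≡ x′ [mod d ] → y ≡ y′ [mod d ] → x - y ≡ x′ - y′ [mod d ]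
  sub-cong-≡mod x≡x′ y≡y′ = +-cong-≡mod x≡x′ (-‿cong-≡mod y≡y′)

  +-congˡ-≡mod : ∀ x {y y′} → y ≡ y′ [mod d ] → x + y ≡ x + y′ [mod d ]
  +-congˡ-≡mod x = +-cong-≡mod (≡mod-refl {x = x})

  +-congʳ-≡mod : ∀ y {x x′} → x ≡ x′ [mod d ] → x + y ≡ x′ + y [mod d ]
  +-congʳ-≡mod y x≡x′ = +-cong-≡mod x≡x′ (≡mod-refl {x = y})

  *-congˡ-≡mod : ∀ x {y y′} → y ≡ y′ [mod d ] → x * y ≡ x * y′ [mod d ]
  *-congˡ-≡mod x = *-cong-≡mod (≡mod-refl {x = x})

  *-congʳ-≡mod : ∀ y {x x′} → x ≡ x′ [mod d ] → x * y ≡ x′ * y [mod d ]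
  *-congʳ-≡mod y x≡x′ = *-cong-≡mod x≡x′ (≡mod-refl {x = y})

  sub-congˡ-≡mod : ∀ x {y y′} → y ≡ y′ [mod d ] → x - y ≡ x - y′ [mod d ]
  sub-congˡ-≡mod x = sub-cong-≡mod (≡mod-refl {x = x})

  multiple-≡mod-0 : ∀ k → k * d ≡ + 0 [mod d ]
  multiple-≡mod-0 k = ≡mod (ℤ∣.divides k (ℤP.+-identityʳ (k * d)))

  ≡mod-0⇒∣ : ∀ {x} → x ≡ + 0 [mod d ] → d ℤ∣.∣ x
  ≡mod-0⇒∣ {x} (≡mod d∣x-0) = subst (d ℤ∣.∣_) (ℤP.+-identityʳ x) d∣x-0

  ∣⇒≡mod-0 : ∀ {x} → d ℤ∣.∣ x → x ≡ + 0 [mod d ]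
  ∣⇒≡mod-0 {x} d∣x = ≡mod (subst (d ℤ∣.∣_) (sym (ℤP.+-identityʳ x)) d∣x)

  sumFin-cong-≡mod : ∀ t {f g : Fin t → ℤ} → (∀ i → f i ≡ g i [mod d ]) → sumFin t f ≡ sumFin t g [mod d ]
  sumFin-cong-≡mod zero    f≡g = ≡mod-refl
  sumFin-cong-≡mod (suc t) f≡g = +-cong-≡mod (f≡g Fin.zero) (sumFin-cong-≡mod t (f≡g ∘ Fin.suc))

  ⟨⟩-congʳ-≡mod : ∀ {t} (f : Fin t → ℤ) {g g′ : Fin t → ℤ} → (∀ i → g i ≡ g′ i [mod d ]) →
    ⟨ f , g ⟩ ≡ ⟨ f , g′ ⟩ [mod d ]
  ⟨⟩-congʳ-≡mod {t} f g≡g′ = sumFin-cong-≡mod t (λ i → *-congˡ-≡mod (f i) (g≡g′ i))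

≡mod-setoid : ℤ → Setoid _ _
≡mod-setoid d = record
  { Carrier       = ℤ
  ; _≈_           = _≡_[mod d ]
  ; isEquivalence = record { refl = ≡mod-refl ; sym = ≡mod-sym ; trans = ≡mod-trans }
  }

module ≡mod-Reasoning (d : ℤ) where
  open import Relation.Binary.Reasoning.Setoid (≡mod-setoid d) public

-- Dual bases modulo d

IsDual : ∀ {n t} → ℤ → (w φ : Fin t → Vecℤ n) → Set
IsDual d w φ = ∀ i j → ⟨ φ i , w j ⟩ ≡ δ i j [mod d ]

module _ {n : ℕ} {d : ℤ} where

  IsDual-∘ : ∀ {s t} {w φ : Fin t → Vecℤ n} {ι : Fin s → Fin t} →
    Injective _≡_ _≡_ ι → IsDual d w φ → IsDual d (w ∘ ι) (φ ∘ ι)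
  IsDual-∘ {ι = ι} ι-injective dual i j =
    ≡mod-trans (dual (ι i) (ι j)) (≡mod-reflexive (δ-injective ι-injective i j))

  dual-coordinate : ∀ {t} {w φ : Fin t → Vecℤ n} → IsDual d w φ →
    ∀ a i → ⟨ φ i , lincomb a w ⟩ ≡ a i [mod d ]
  dual-coordinate {w = w} {φ} dual a i = begin
    ⟨ φ i , lincomb a w ⟩              ≡⟨ ⟨⟩-lincomb (φ i) a w ⟩
    ⟨ a , (λ j → ⟨ φ i , w j ⟩) ⟩      ≈⟨ ⟨⟩-congʳ-≡mod a (dual i) ⟩
    ⟨ a , δ i ⟩                        ≡⟨ ⟨⟩-comm a (δ i) ⟩
    ⟨ δ i , a ⟩                        ≡⟨ δ-sift i a ⟩
    a i                                ∎
    where open ≡mod-Reasoning d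

dual⇒independent : ∀ {n t p} {w φ : Fin t → Vecℤ n} → IsDual (+ p) w φ → FullColumnRankModp p w
dual⇒independent {w = w} {φ} dual c p∣lincomb i = ℤ∣.∣⇒∣ᵤ (≡mod-0⇒∣ (begin
  c i                        ≈⟨ dual-coordinate {w = w} {φ} dual c i ⟨
  ⟨ φ i , lincomb c w ⟩      ≈⟨ ⟨⟩-congʳ-≡mod (φ i) (λ r → ∣⇒≡mod-0 (ℤ∣.∣ᵤ⇒∣ (p∣lincomb r))) ⟩
  ⟨ φ i , (λ _ → + 0) ⟩      ≡⟨ ⟨⟩-zeroʳ (φ i) ⟩
  + 0                        ∎))
  where open ≡mod-Reasoning _

residual-coordinate : ∀ {n t d} {u ψ : Fin t → Vecℤ n} → IsDual d u ψ → ∀ e i →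
  ⟨ ψ i , (λ r → e r - lincomb (λ j → ⟨ ψ j , e ⟩) u r) ⟩ ≡ + 0 [mod d ]
residual-coordinate {d = d} {u} {ψ} dual e i = begin
  ⟨ ψ i , (λ r → e r - lincomb a u r) ⟩     ≡⟨ ⟨⟩-diffʳ (ψ i) e (lincomb a u) ⟩
  ⟨ ψ i , e ⟩ - ⟨ ψ i , lincomb a u ⟩       ≈⟨ sub-congˡ-≡mod ⟨ ψ i , e ⟩ (dual-coordinate {w = u} {ψ} dual a i) ⟩
  ⟨ ψ i , e ⟩ - ⟨ ψ i , e ⟩                 ≡⟨ ℤP.+-inverseʳ ⟨ ψ i , e ⟩ ⟩
  + 0                                       ∎
  where
  open ≡mod-Reasoning d
  a = λ j → ⟨ ψ j , e ⟩

module _ {n : ℕ} where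

  updateAt-δ : ∀ (w : Fin n → Vecℤ n) k z s r → updateAt w k (const z) s r ≡ w s r + δ k s * (z r - w s r)
  updateAt-δ w k z s r with k ≟ s
  ... | yes refl = trans (cong (_$ r) (updateAt-updates k w))
    (trans (replace (w k r) (z r)) (cong (λ e → w k r + e * (z r - w k r)) (sym (δ-diag k))))
    where
    replace : ∀ x y → y ≡ x + + 1 * (y - x)
    replace = solve-∀
  ... | no k≢s = begin
    updateAt w k (const z) s r      ≡⟨ cong (_$ r) (updateAt-minimal s k w (k≢s ∘ sym)) ⟩
    w s r                           ≡⟨ ℤP.+-identityʳ (w s r) ⟨
    w s r + + 0 * (z r - w s r)     ≡⟨ cong (λ e → w s r + e * (z r - w s r)) (δ-off k≢s) ⟨
    w s r + δ k s * (z r - w s r)   ∎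
    where open ≡-Reasoning

  lincomb-updateAt : ∀ (x : Fin n → ℤ) (w : Fin n → Vecℤ n) k z r →
    lincomb x (updateAt w k (const z)) r ≡ lincomb x w r + x k * (z r - w k r)
  lincomb-updateAt x w k z r = begin
    ⟨ x , (λ s → updateAt w k (const z) s r) ⟩
      ≡⟨ sumFin-cong n pointwise ⟩
    sumFin n (λ s → x s * w s r + δ k s * (x s * (z r - w s r)))
      ≡⟨ sumFin-distrib-+ n _ _ ⟩
    lincomb x w r + ⟨ δ k , (λ s → x s * (z r - w s r)) ⟩
      ≡⟨ cong (_+_ (lincomb x w r)) (δ-sift k _) ⟩
    lincomb x w r + x k * (z r - w k r) ∎
    where
    open ≡-Reasoning
    expand : ∀ a b e c → a * (b + e * (c - b)) ≡ a * b + e * (a * (c - b))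
    expand = solve-∀
    pointwise : ∀ s → x s * updateAt w k (const z) s r ≡ x s * w s r + δ k s * (x s * (z r - w s r))
    pointwise s = trans (cong (x s *_) (updateAt-δ w k z s r)) (expand (x s) (w s r) (δ k s) (z r))

record IsDualBasis {n} (d : ℤ) (w φ : Fin n → Vecℤ n) : Set where
  field
    isDual    : IsDual d w φ
    expansion : ∀ u r → u r ≡ lincomb (λ s → ⟨ φ s , u ⟩) w r [mod d ]

open IsDualBasis

module _ {n : ℕ} {d : ℤ} where

  standard-isDualBasis : IsDualBasis d (δ {n}) δ
  standard-isDualBasis = record
    { isDual    = λ i j → ≡mod-reflexive (trans (δ-sift i (δ j)) (δ-sym j i))
    ; expansion = λ u r → ≡mod-reflexive (sym (begin
        ⟨ (λ s → ⟨ δ s , u ⟩) , (λ s → δ s r) ⟩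
          ≡⟨ sumFin-cong n (λ s → cong (_* δ s r) (δ-sift s u)) ⟩
        ⟨ u , (λ s → δ s r) ⟩
          ≡⟨ sumFin-cong n (λ s → trans (ℤP.*-comm (u s) _) (cong (_* u s) (δ-sym s r))) ⟩
        ⟨ δ r , u ⟩
          ≡⟨ δ-sift r u ⟩
        u r ∎))
    }
    where open ≡-Reasoning

  coordinates-≡0⇒≡0 : ∀ {w φ : Fin n → Vecℤ n} → IsDualBasis d w φ → ∀ {u} →
    (∀ s → ⟨ φ s , u ⟩ ≡ + 0 [mod d ]) → ∀ r → u r ≡ + 0 [mod d ]
  coordinates-≡0⇒≡0 {w} {φ} basis {u} coordinates≡0 r = begin
    u r                                          ≈⟨ expansion basis u r ⟩
    ⟨ (λ s → ⟨ φ s , u ⟩) , (λ s → w s r) ⟩      ≈⟨ sumFin-cong-≡mod n (λ s → *-congʳ-≡mod (w s r) (coordinates≡0 s)) ⟩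
    ⟨ (λ _ → + 0) , (λ s → w s r) ⟩              ≡⟨ sumFin-zero n ⟩
    + 0                                          ∎
    where open ≡mod-Reasoning d

  module Pivot {w φ : Fin n → Vecℤ n} (basis : IsDualBasis d w φ) (k : Fin n) (z : Vecℤ n)
               {α : ℤ} (α-inverse : α * ⟨ φ k , z ⟩ ≡ + 1 [mod d ]) where

    w′ : Fin n → Vecℤ n
    w′ = updateAt w k (const z)

    -- One formula for every s; at s = k it gives (α + 1 - α ⟨ φ k , z ⟩) ⋆ φ k ≡ α ⋆ φ k.
    γ : Fin n → ℤ
    γ s = α * (⟨ φ s , z ⟩ - δ k s)

    φ′ : Fin n → Vecℤ n
    φ′ s r = φ s r - γ s * φ k r

    coordinate′ : ∀ s v → ⟨ φ′ s , v ⟩ ≡ ⟨ φ s , v ⟩ - γ s * ⟨ φ k , v ⟩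
    coordinate′ s v =
      trans (⟨⟩-diffˡ (φ s) (γ s ⋆ φ k) v) (cong (_-_ ⟨ φ s , v ⟩) (⟨⟩-⋆ˡ (γ s) (φ k) v))

    isDual′ : IsDual d w′ φ′
    isDual′ s j with j ≟ k
    ... | yes refl = begin
      ⟨ φ′ s , w′ j ⟩                                    ≡⟨ cong ⟨ φ′ s ,_⟩ (updateAt-updates j w) ⟩
      ⟨ φ′ s , z ⟩                                       ≡⟨ coordinate′ s z ⟩
      β s - γ s * β j                                    ≡⟨ regroup (β s) (δ j s) α (β j) ⟩
      β s - (β s - δ j s) * (α * β j)                    ≈⟨ sub-congˡ-≡mod (β s) (*-congˡ-≡mod (β s - δ j s) α-inverse) ⟩
      β s - (β s - δ j s) * + 1                          ≡⟨ cancel (β s) (δ j s) ⟩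
      δ j s                                              ≡⟨ δ-sym j s ⟩
      δ s j                                              ∎
      where
      open ≡mod-Reasoning d
      β : Fin n → ℤ
      β s = ⟨ φ s , z ⟩
      regroup : ∀ x e a y → x - (a * (x - e)) * y ≡ x - (x - e) * (a * y)
      regroup = solve-∀
      cancel : ∀ x e → x - (x - e) * + 1 ≡ e
      cancel = solve-∀
    ... | no j≢k = begin
      ⟨ φ′ s , w′ j ⟩                                    ≡⟨ cong ⟨ φ′ s ,_⟩ (updateAt-minimal j k w j≢k) ⟩
      ⟨ φ′ s , w j ⟩                                     ≡⟨ coordinate′ s (w j) ⟩
      ⟨ φ s , w j ⟩ - γ s * ⟨ φ k , w j ⟩
        ≈⟨ sub-cong-≡mod (isDual basis s j) (*-congˡ-≡mod (γ s) (isDual basis k j)) ⟩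
      δ s j - γ s * δ k j                                ≡⟨ cong (λ e → δ s j - γ s * e) (δ-off (j≢k ∘ sym)) ⟩
      δ s j - γ s * + 0                                  ≡⟨ cong (λ e → δ s j - e) (ℤP.*-zeroʳ (γ s)) ⟩
      δ s j - + 0                                        ≡⟨ ℤP.+-identityʳ (δ s j) ⟩
      δ s j                                              ∎
      where open ≡mod-Reasoning d

    γ-combination : ∀ r → lincomb γ w′ r ≡ z r - w k r [mod d ]
    γ-combination r = begin
      lincomb γ w′ r                                   ≡⟨ lincomb-updateAt γ w k z r ⟩
      ⟨ γ , col ⟩ + γ k * D                            ≡⟨ cong (_+ γ k * D) (⟨⟩-⋆ˡ α (λ s → ⟨ φ s , z ⟩ - δ k s) col) ⟩
      α * ⟨ (λ s → ⟨ φ s , z ⟩ - δ k s) , col ⟩ + γ k * D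
                                                       ≡⟨ cong (λ e → α * e + γ k * D) (⟨⟩-diffˡ (λ s → ⟨ φ s , z ⟩) (δ k) col) ⟩
      α * (lincomb (λ s → ⟨ φ s , z ⟩) w r - ⟨ δ k , col ⟩) + γ k * D
                                                       ≈⟨ +-congʳ-≡mod (γ k * D) (*-congˡ-≡mod α
                                                            (sub-cong-≡mod (≡mod-sym (expansion basis z r))
                                                                           (≡mod-reflexive (δ-sift k col)))) ⟩
      α * D + α * (β - δ k k) * D                      ≡⟨ cong (λ e → α * D + α * (β - e) * D) (δ-diag k) ⟩
      α * D + α * (β - + 1) * D                        ≡⟨ collect α β D ⟩
      (α * β) * D                                      ≈⟨ *-congʳ-≡mod D α-inverse ⟩
      + 1 * D                                          ≡⟨ ℤP.*-identityˡ D ⟩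
      D                                                ∎
      where
      open ≡mod-Reasoning d
      col = λ s → w s r
      β = ⟨ φ k , z ⟩
      D = z r - w k r
      collect : ∀ a b x → a * x + a * (b - + 1) * x ≡ (a * b) * x
      collect = solve-∀

    expansion′ : ∀ u r → u r ≡ lincomb (λ s → ⟨ φ′ s , u ⟩) w′ r [mod d ]
    expansion′ u r = ≡mod-sym (begin
      lincomb (λ s → ⟨ φ′ s , u ⟩) w′ r          ≡⟨ sumFin-cong n (λ s → cong (_* w′ s r) (coordinate-u s)) ⟩
      ⟨ (λ s → a s - a k * γ s) , col′ ⟩          ≡⟨ ⟨⟩-diffˡ a (a k ⋆ γ) col′ ⟩
      ⟨ a , col′ ⟩ - ⟨ a k ⋆ γ , col′ ⟩           ≡⟨ cong₂ _-_ (lincomb-updateAt a w k z r) (⟨⟩-⋆ˡ (a k) γ col′) ⟩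
      (lincomb a w r + a k * D) - a k * lincomb γ w′ r
                                                  ≈⟨ sub-cong-≡mod (+-congʳ-≡mod (a k * D) (≡mod-sym (expansion basis u r)))
                                                                   (*-congˡ-≡mod (a k) (γ-combination r)) ⟩
      (u r + a k * D) - a k * D                   ≡⟨ m+n-n≡m (u r) (a k * D) ⟩
      u r                                         ∎)
      where
      open ≡mod-Reasoning d
      a = λ s → ⟨ φ s , u ⟩
      col′ = λ s → w′ s r
      D = z r - w k r
      coordinate-u : ∀ s → ⟨ φ′ s , u ⟩ ≡ a s - a k * γ s
      coordinate-u s = trans (coordinate′ s u) (cong (_-_ (a s)) (ℤP.*-comm (γ s) (a k)))

  pivot : ∀ {w φ : Fin n → Vecℤ n} → IsDualBasis d w φ → ∀ k z {α} →
    α * ⟨ φ k , z ⟩ ≡ + 1 [mod d ] → ∃ λ φ′ → IsDualBasis d (updateAt w k (const z)) φ′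
  pivot basis k z {α} α-inverse =
    φ′ , record { isDual = isDual′ ; expansion = expansion′ }
    where open Pivot basis k z {α} α-inverse

  exchange : ∀ {w φ : Fin n → Vecℤ n} → IsDualBasis d w φ → ∀ {s} k z {α} →
    α * ⟨ φ s , z ⟩ ≡ + 1 [mod d ] →
    ∃₂ λ w′ φ′ → IsDualBasis d w′ φ′ × w′ k ≡ z × (∀ j → j ≢ s → j ≢ k → w′ j ≡ w j)
  exchange {w} {φ} basis {s} k z {α} α-inverse with s ≟ k
  ... | yes refl =
    let φ′ , basis′ = pivot basis k z {α} α-inverse in
    updateAt w k (const z) , φ′ , basis′ , updateAt-updates k w ,
    λ j _ j≢k → updateAt-minimal j k w j≢k
  ... | no s≢k =
    updateAt w₁ k (const z) , φ₂ , basis₂ , updateAt-updates k w₁ ,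
    λ j j≢s j≢k → trans (updateAt-minimal j k w₁ j≢k) (updateAt-minimal j s w j≢s)
    where
    -- First exchange w s for w k + z, whose s-coordinate is still ⟨ φ s , z ⟩;
    -- afterwards z = w₁ s - w₁ k has k-coordinate -1.
    z₁ : Vecℤ n
    z₁ r = w k r + z r

    α-inverse₁ : α * ⟨ φ s , z₁ ⟩ ≡ + 1 [mod d ]
    α-inverse₁ = begin
      α * ⟨ φ s , z₁ ⟩                   ≡⟨ cong (α *_) (⟨⟩-+ʳ (φ s) (w k) z) ⟩
      α * (⟨ φ s , w k ⟩ + ⟨ φ s , z ⟩)  ≈⟨ *-congˡ-≡mod α (+-congʳ-≡mod ⟨ φ s , z ⟩ (isDual basis s k)) ⟩
      α * (δ s k + ⟨ φ s , z ⟩)          ≡⟨ cong (λ e → α * (e + ⟨ φ s , z ⟩)) (δ-off s≢k) ⟩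
      α * (+ 0 + ⟨ φ s , z ⟩)            ≡⟨ cong (α *_) (ℤP.+-identityˡ _) ⟩
      α * ⟨ φ s , z ⟩                    ≈⟨ α-inverse ⟩
      + 1                                ∎
      where open ≡mod-Reasoning d

    w₁ = updateAt w s (const z₁)
    φ₁ = proj₁ (pivot basis s z₁ {α} α-inverse₁)
    basis₁ = proj₂ (pivot basis s z₁ {α} α-inverse₁)

    z≡w₁s-w₁k : ∀ r → z r ≡ w₁ s r - w₁ k r
    z≡w₁s-w₁k r = sym (trans
      (cong₂ (λ x y → x r - y r) (updateAt-updates s w) (updateAt-minimal k s w (s≢k ∘ sym)))
      (m+n-m≡n (w k r) (z r)))

    minus-one-inverse : -1ℤ * ⟨ φ₁ k , z ⟩ ≡ + 1 [mod d ]
    minus-one-inverse = begin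
      -1ℤ * ⟨ φ₁ k , z ⟩                          ≡⟨ cong (-1ℤ *_) z-coordinate ⟩
      -1ℤ * (⟨ φ₁ k , w₁ s ⟩ - ⟨ φ₁ k , w₁ k ⟩)   ≈⟨ *-congˡ-≡mod -1ℤ (sub-cong-≡mod (isDual basis₁ k s) (isDual basis₁ k k)) ⟩
      -1ℤ * (δ k s - δ k k)                       ≡⟨ cong₂ (λ x y → -1ℤ * (x - y)) (δ-off (s≢k ∘ sym)) (δ-diag k) ⟩
      + 1                                         ∎
      where
      open ≡mod-Reasoning d
      z-coordinate : ⟨ φ₁ k , z ⟩ ≡ ⟨ φ₁ k , w₁ s ⟩ - ⟨ φ₁ k , w₁ k ⟩
      z-coordinate = trans (sumFin-cong n (λ r → cong (φ₁ k r *_) (z≡w₁s-w₁k r))) (⟨⟩-diffʳ (φ₁ k) (w₁ s) (w₁ k))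

    φ₂ = proj₁ (pivot basis₁ k z {α = -1ℤ} minus-one-inverse)
    basis₂ = proj₂ (pivot basis₁ k z {α = -1ℤ} minus-one-inverse)

-- Inverses modulo a prime

module _ {p : ℕ} where

  bézout⇒inverse : ∀ {a} → Bézout.Identity 1 a p → ∃ λ α → α * + a ≡ + 1 [mod + p ]
  bézout⇒inverse {a} (Bézout.+- x y 1+yp≡xa) = + x , ≡mod (ℤ∣.divides (+ y) (begin
    + x * + a - + 1         ≡⟨ cong (_- + 1) (ℤP.pos-* x a) ⟨
    + (x ℕ.* a) - + 1       ≡⟨ cong (λ e → + e - + 1) 1+yp≡xa ⟨
    + (1 ℕ.+ y ℕ.* p) - + 1  ≡⟨ cong (_- + 1) (trans (ℤP.pos-+ 1 (y ℕ.* p)) (cong (_+_ (+ 1)) (ℤP.pos-* y p))) ⟩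
    + 1 + + y * + p - + 1   ≡⟨ m+n-m≡n (+ 1) (+ y * + p) ⟩
    + y * + p               ∎))
    where open ≡-Reasoning
  bézout⇒inverse {a} (Bézout.-+ x y 1+xa≡yp) = - + x , ≡mod (ℤ∣.divides (- + y) (begin
    - + x * + a - + 1       ≡⟨ negate (+ x) (+ a) ⟩
    - (+ 1 + + x * + a)     ≡⟨ cong (λ e → - (+ 1 + e)) (ℤP.pos-* x a) ⟨
    - + (1 ℕ.+ x ℕ.* a)     ≡⟨ cong (λ e → - + e) 1+xa≡yp ⟩
    - + (y ℕ.* p)           ≡⟨ cong -_ (ℤP.pos-* y p) ⟩
    - (+ y * + p)           ≡⟨ ℤP.neg-distribˡ-* (+ y) (+ p) ⟩
    - + y * + p             ∎))
    where
    open ≡-Reasoning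
    negate : ∀ x a → - x * a - + 1 ≡ - (+ 1 + x * a)
    negate = solve-∀

  prime∤⇒coprime : Prime p → ∀ {a} → ¬ p ℕ∣.∣ a → Coprime a p
  prime∤⇒coprime p-prime p∤a (e∣a , e∣p) with prime⇒irreducible p-prime e∣p
  ... | inj₁ e≡1 = e≡1
  ... | inj₂ refl = ⊥-elim (p∤a e∣a)

  inverse-mod-prime : Prime p → ∀ β → ¬ (+ p ℤ∣.∣ β) → ∃ λ α → α * β ≡ + 1 [mod + p ]
  inverse-mod-prime p-prime (+ a) p∤β =
    bézout⇒inverse (coprime-Bézout (prime∤⇒coprime p-prime (p∤β ∘ ℤ∣.∣ᵤ⇒∣)))
  inverse-mod-prime p-prime -[1+ a ] p∤β =
    let α , α-inverse = bézout⇒inverse (coprime-Bézout (prime∤⇒coprime p-prime (p∤β ∘ ℤ∣.∣ᵤ⇒∣))) in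
    - α , ≡mod-trans (≡mod-reflexive (neg*neg α (+ suc a))) α-inverse
    where
    neg*neg : ∀ x y → - x * - y ≡ x * y
    neg*neg = solve-∀

-- Spans modulo N

infix 4 _∈span_[mod_] _⊆span_[mod_]

-- InSpanMod as a record (with signed divisibility), so that w and u can be inferred.

record _∈span_[mod_] {n t} (w : Vecℤ n) (u : Fin t → Vecℤ n) (N : ℤ) : Set where
  constructor span
  field
    coeffs   : Fin t → ℤ
    ≡lincomb : ∀ r → w r ≡ lincomb coeffs u r [mod N ]

_⊆span_[mod_] : ∀ {n s t} → (Fin s → Vecℤ n) → (Fin t → Vecℤ n) → ℤ → Set
u ⊆span v [mod N ] = ∀ i → u i ∈span v [mod N ]

module _ {n : ℕ} {N : ℤ} where

  lincomb-∈span : ∀ {t} (c : Fin t → ℤ) (u : Fin t → Vecℤ n) → lincomb c u ∈span u [mod N ]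
  lincomb-∈span c u = span c (λ r → ≡mod-refl)

  generator-∈span : ∀ {t} (u : Fin t → Vecℤ n) i → u i ∈span u [mod N ]
  generator-∈span u i = span (δ i) (λ r → ≡mod-reflexive (sym (δ-sift i (λ j → u j r))))

  ∈span-resp-≡mod : ∀ {t} {w w′ : Vecℤ n} {u : Fin t → Vecℤ n} →
    (∀ r → w r ≡ w′ r [mod N ]) → w′ ∈span u [mod N ] → w ∈span u [mod N ]
  ∈span-resp-≡mod w≡w′ (span c w′≡) = span c (λ r → ≡mod-trans (w≡w′ r) (w′≡ r))

  ∈span-+ : ∀ {t} {w w′ : Vecℤ n} {u : Fin t → Vecℤ n} →
    w ∈span u [mod N ] → w′ ∈span u [mod N ] → (λ r → w r + w′ r) ∈span u [mod N ]
  ∈span-+ {u = u} (span c w≡) (span c′ w′≡) = span (λ i → c i + c′ i) λ r →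
    ≡mod-trans (+-cong-≡mod (w≡ r) (w′≡ r)) (≡mod-reflexive (sym (⟨⟩-+ˡ c c′ (λ i → u i r))))

  ∈span-diff : ∀ {t} {w w′ : Vecℤ n} {u : Fin t → Vecℤ n} →
    w ∈span u [mod N ] → w′ ∈span u [mod N ] → (λ r → w r - w′ r) ∈span u [mod N ]
  ∈span-diff {u = u} (span c w≡) (span c′ w′≡) = span (λ i → c i - c′ i) λ r →
    ≡mod-trans (sub-cong-≡mod (w≡ r) (w′≡ r)) (≡mod-reflexive (sym (⟨⟩-diffˡ c c′ (λ i → u i r))))

  ∈span-≗ : ∀ {t} {w : Vecℤ n} {u v : Fin t → Vecℤ n} →
    (∀ i → u i ≡ v i) → w ∈span u [mod N ] → w ∈span v [mod N ]
  ∈span-≗ u≗v (span c w≡) = span c (λ r →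
    ≡mod-trans (w≡ r) (≡mod-reflexive (sumFin-cong _ (λ i → cong (λ x → c i * x r) (u≗v i)))))

  ∈span-trans : ∀ {s t} {w : Vecℤ n} {u : Fin s → Vecℤ n} {v : Fin t → Vecℤ n} →
    u ⊆span v [mod N ] → w ∈span u [mod N ] → w ∈span v [mod N ]
  ∈span-trans {w = w} {u} {v} u⊆v (span c w≡) = span (lincomb c A) λ r → begin
    w r                                      ≈⟨ w≡ r ⟩
    ⟨ c , (λ i → u i r) ⟩                    ≈⟨ ⟨⟩-congʳ-≡mod c (λ i → ≡lincomb (u⊆v i) r) ⟩
    ⟨ c , (λ i → ⟨ A i , (λ j → v j r) ⟩) ⟩  ≡⟨ sumFin-cong _ (λ i → cong (c i *_) (⟨⟩-comm (A i) _)) ⟩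
    ⟨ c , (λ i → ⟨ (λ j → v j r) , A i ⟩) ⟩  ≡⟨ ⟨⟩-lincomb (λ j → v j r) c A ⟨
    ⟨ (λ j → v j r) , lincomb c A ⟩          ≡⟨ ⟨⟩-comm _ (lincomb c A) ⟩
    lincomb (lincomb c A) v r                ∎
    where
    open ≡mod-Reasoning N
    open _∈span_[mod_]
    A : ∀ i → Fin _ → ℤ
    A i = coeffs (u⊆v i)

  ⊆span-trans : ∀ {s t o} {u : Fin s → Vecℤ n} {v : Fin t → Vecℤ n} {x : Fin o → Vecℤ n} →
    u ⊆span v [mod N ] → v ⊆span x [mod N ] → u ⊆span x [mod N ]
  ⊆span-trans u⊆v v⊆x i = ∈span-trans v⊆x (u⊆v i)

  ⊆span⇒SpanEqMod : ∀ {s t} {u : Fin s → Vecℤ n} {v : Fin t → Vecℤ n} →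
    u ⊆span v [mod N ] → v ⊆span u [mod N ] → SpanEqMod N u v
  ⊆span⇒SpanEqMod u⊆v v⊆u w = from ∘ ∈span-trans u⊆v ∘ to , from ∘ ∈span-trans v⊆u ∘ to
    where
    to : ∀ {t} {u : Fin t → Vecℤ n} → InSpanMod N w u → w ∈span u [mod N ]
    to (c , w≡) = span c (λ r → ≡mod (ℤ∣.∣ᵤ⇒∣ (w≡ r)))
    from : ∀ {t} {u : Fin t → Vecℤ n} → w ∈span u [mod N ] → InSpanMod N w u
    from (span c w≡) = c , (λ r → ℤ∣.∣⇒∣ᵤ (divides-diff (w≡ r)))

infix 4 _≈span_[mod_]

_≈span_[mod_] : ∀ {n s t} → (Fin s → Vecℤ n) → (Fin t → Vecℤ n) → ℤ → Set
u ≈span v [mod N ] = u ⊆span v [mod N ] × v ⊆span u [mod N ]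

module _ {n : ℕ} {N : ℤ} where

  ≈span-≗ : ∀ {s t} {u u′ : Fin s → Vecℤ n} {v v′ : Fin t → Vecℤ n} →
    (∀ i → u i ≡ u′ i) → (∀ j → v j ≡ v′ j) → u ≈span v [mod N ] → u′ ≈span v′ [mod N ]
  ≈span-≗ u≗u′ v≗v′ (u⊆v , v⊆u) =
    (λ i → subst (_∈span _ [mod N ]) (u≗u′ i) (∈span-≗ v≗v′ (u⊆v i))) ,
    (λ j → subst (_∈span _ [mod N ]) (v≗v′ j) (∈span-≗ u≗u′ (v⊆u j)))

  ≈span-extend : ∀ {k} {G H : Fin (suc k) → Vecℤ n} →
    (G ∘ Fin.inject₁) ≈span (H ∘ Fin.inject₁) [mod N ] → (c : Fin k → ℤ) →
    (∀ r → G (Fin.fromℕ k) r ≡ lincomb c (G ∘ Fin.inject₁) r + H (Fin.fromℕ k) r [mod N ]) →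
    G ≈span H [mod N ]
  ≈span-extend {k} {G} {H} (G⊆H , H⊆G) c G-last≡ =
    inject₁-or-last (λ j → ∈span-trans H-init⊆H (G⊆H j))
      (∈span-resp-≡mod G-last≡
        (∈span-+ (∈span-trans (⊆span-trans G⊆H H-init⊆H) (lincomb-∈span c _)) (generator-∈span H _))) ,
    inject₁-or-last (λ j → ∈span-trans G-init⊆G (H⊆G j))
      (∈span-resp-≡mod H-last≡
        (∈span-diff (generator-∈span G _) (∈span-trans G-init⊆G (lincomb-∈span c _))))
    where
    G-init⊆G : (G ∘ Fin.inject₁) ⊆span G [mod N ]
    G-init⊆G j = generator-∈span G (Fin.inject₁ j)

    H-init⊆H : (H ∘ Fin.inject₁) ⊆span H [mod N ]
    H-init⊆H j = generator-∈span H (Fin.inject₁ j)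

    inject₁-or-last : ∀ {P : Fin (suc k) → Set} → (∀ j → P (Fin.inject₁ j)) → P (Fin.fromℕ k) → ∀ i → P i
    inject₁-or-last {P} P-inject₁ P-last i with k ℕ.≟ toℕ i
    ... | yes k≡i = subst P (FinP.toℕ-injective (trans (FinP.toℕ-fromℕ k) k≡i)) P-last
    ... | no k≢i  = subst P (FinP.inject₁-lower₁ i k≢i) (P-inject₁ _)

    H-last≡ : ∀ r → H (Fin.fromℕ k) r ≡ G (Fin.fromℕ k) r - lincomb c (G ∘ Fin.inject₁) r [mod N ]
    H-last≡ r = ≡mod-trans (≡mod-reflexive (sym (m+n-m≡n (lincomb c (G ∘ Fin.inject₁) r) _)))
                           (sub-cong-≡mod (≡mod-sym (G-last≡ r)) ≡mod-refl)

-- Krylov vectors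

pos-^-split : ∀ p {j M} → j ≤ M → + (p ^ M) ≡ + (p ^ (M ∸ j)) * + (p ^ j)
pos-^-split p {j} {M} j≤M = begin
  + (p ^ M)                     ≡⟨ cong (λ e → + (p ^ e)) (ℕP.m∸n+n≡m j≤M) ⟨
  + (p ^ (M ∸ j ℕ.+ j))         ≡⟨ cong +_ (ℕP.^-distribˡ-+-* p (M ∸ j) j) ⟩
  + (p ^ (M ∸ j) ℕ.* p ^ j)     ≡⟨ ℤP.pos-* (p ^ (M ∸ j)) (p ^ j) ⟩
  + (p ^ (M ∸ j)) * + (p ^ j)   ∎
  where open ≡-Reasoning

module _ {n p : ℕ} {X : Matℤ n} {b : Vecℤ n} where

  UPred-suc : ∀ {k j} → UPred p X b k j → UPred p X b (suc k) j
  UPred-suc {k} {j} (c , e , K≡) = (+ 0 ∷ c) , X · e , λ r → begin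
    ⟨ X r , Xpow X b k ⟩                            ≡⟨ sumFin-cong n (λ s → cong (X r s *_) (K≡ s)) ⟩
    ⟨ X r , (λ s → lincomb c K s + pʲ * e s) ⟩       ≡⟨ ⟨⟩-+ʳ (X r) (lincomb c K) (pʲ ⋆ e) ⟩
    ⟨ X r , lincomb c K ⟩ + ⟨ X r , pʲ ⋆ e ⟩        ≡⟨ cong₂ _+_ (⟨⟩-lincomb (X r) c K) (⟨⟩-⋆ʳ (X r) pʲ e) ⟩
    ⟨ c , (λ i → ⟨ X r , K i ⟩) ⟩ + pʲ * (X · e) r
      ≡⟨ cong (_+ pʲ * (X · e) r) (ℤP.+-identityˡ ⟨ c , (λ i → ⟨ X r , K i ⟩) ⟩) ⟨
    lincomb (+ 0 ∷ c) (λ i → Xpow X b (toℕ i)) r + pʲ * (X · e) r ∎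
    where
    open ≡-Reasoning
    pʲ = + (p ^ j)
    K : Fin k → Vecℤ n
    K i = Xpow X b (toℕ i)

  UPred-mono : ∀ {k k′ j} → k ≤ k′ → UPred p X b k j → UPred p X b k′ j
  UPred-mono {j = j} k≤k′ = go {j = j} (ℕP.≤⇒≤′ k≤k′)
    where
    go : ∀ {k k′ j} → k ℕ.≤′ k′ → UPred p X b k j → UPred p X b k′ j
    go ℕ.≤′-refl               u = u
    go {j = j} (ℕ.≤′-step k≤′k′) u = UPred-suc {j = j} (go {j = j} k≤′k′ u)

  UPred-from-≡mod : ∀ {k j M} → j ≤ M → (c : Fin k → ℤ) (z : Vecℤ n) →
    (∀ r → Xpow X b k r ≡ lincomb c (λ i → Xpow X b (toℕ i)) r + + (p ^ j) * z r [mod + (p ^ M) ]) →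
    UPred p X b k j
  UPred-from-≡mod {k} {j} {M} j≤M c z K≡ = c , (λ r → z r + g r * + (p ^ (M ∸ j))) , λ r → begin
    Xpow X b k r                                 ≡⟨ split (Xpow X b k r) (L r + pʲ * z r) ⟩
    (Xpow X b k r - (L r + pʲ * z r)) + (L r + pʲ * z r)
                                                 ≡⟨ cong (_+ (L r + pʲ * z r)) (ℤ∣._∣_.equality (divides-diff (K≡ r))) ⟩
    g r * + (p ^ M) + (L r + pʲ * z r)           ≡⟨ cong (λ e → g r * e + (L r + pʲ * z r)) (pos-^-split p j≤M) ⟩
    g r * (+ (p ^ (M ∸ j)) * pʲ) + (L r + pʲ * z r)
                                                 ≡⟨ collect (g r) (+ (p ^ (M ∸ j))) pʲ (L r) (z r) ⟩
    L r + pʲ * (z r + g r * + (p ^ (M ∸ j)))     ∎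
    where
    open ≡-Reasoning
    pʲ = + (p ^ j)
    L : Vecℤ n
    L = lincomb c (λ i → Xpow X b (toℕ i))
    g : Vecℤ n
    g r = ℤ∣.quotient (divides-diff (K≡ r))
    split : ∀ x y → x ≡ (x - y) + y
    split = solve-∀
    collect : ∀ g q P l z → g * (q * P) + (l + P * z) ≡ l + P * (z + g * q)
    collect = solve-∀

module Construction {p : ℕ} (p-prime : Prime p) (m : ℕ) {n : ℕ} (X : Matℤ n) (b : Vecℤ n)
                    (Λ : Fin n → ℕ) (Λ-minSup : ∀ k → IsMinSupM (UPred p X b (toℕ k)) m (Λ k)) where

  Q : ℤ
  Q = + (p ^ m)

  krylov : ∀ t → Fin t → Vecℤ n
  krylov t i = Xpow X b (toℕ i)

  scaledAt : (Fin n → Vecℤ n) → Fin n → Vecℤ n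
  scaledAt v κ = (+ (p ^ Λ κ)) ⋆ v κ

  scaledAt-cong : ∀ {v v′ : Fin n → Vecℤ n} κ → v κ ≡ v′ κ → scaledAt v κ ≡ scaledAt v′ κ
  scaledAt-cong κ = cong ((+ (p ^ Λ κ)) ⋆_)

  scaled : ∀ t → .(t ≤ n) → (Fin n → Vecℤ n) → Fin t → Vecℤ n
  scaled t t≤n v i = scaledAt v (inject≤ i t≤n)

  Adapted : ℕ → (Fin n → Vecℤ n) → Set
  Adapted k v = ∀ t (t≤n : t ≤ n) → t ≤ k → krylov t ≈span scaled t t≤n v [mod Q ]

  record State (k : ℕ) : Set where
    field
      w φ     : Fin n → Vecℤ n
      basis   : IsDualBasis (+ p) w φ
      adapted : Adapted k w

  initial : State 0
  initial = record
    { w       = δ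
    ; φ       = δ
    ; basis   = standard-isDualBasis
    ; adapted = λ { _ _ z≤n → (λ ()) , (λ ()) }
    }

  Λ-mono : ∀ {i k} → toℕ i ≤ toℕ k → Λ i ≤ Λ k
  Λ-mono {i} {k} i≤k with m ℕP.≤? Λ k
  ... | yes m≤Λk = ℕP.≤-trans (proj₁ (Λ-minSup i)) m≤Λk
  ... | no m≰Λk  = proj₂ (proj₂ (Λ-minSup k)) (ℕP.≰⇒> m≰Λk) (Λ i)
                     (UPred-mono {j = Λ i} i≤k (proj₁ (proj₂ (Λ-minSup i))))

  extend : ∀ {w w′ : Fin n → Vecℤ n} (κ : Fin n) → Adapted (toℕ κ) w →
    (∀ j → toℕ j < toℕ κ → w′ j ≡ w j) → (c : Fin (toℕ κ) → ℤ) →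
    (∀ r → Xpow X b (toℕ κ) r ≡ lincomb c (krylov (toℕ κ)) r + scaledAt w′ κ r [mod Q ]) →
    Adapted (suc (toℕ κ)) w′
  extend {w} {w′} κ adapted agree c K≡ t t≤n t≤1+k with ℕP.m≤n⇒m<n∨m≡n t≤1+k
  ... | inj₁ t<1+k = ≈span-≗ (λ _ → refl)
    (λ i → scaledAt-cong {w} {w′} _ (sym (agree _ (ℕP.<-≤-trans (toℕ-inject≤< i t≤n) (ℕP.≤-pred t<1+k)))))
    (adapted t t≤n (ℕP.≤-pred t<1+k))
  ... | inj₂ refl = ≈span-extend (≈span-≗ krylov-init scaled-init (adapted k k≤n ℕP.≤-refl)) c K≡′
    where
    k = toℕ κ
    k≤n = FinP.toℕ≤n κ

    krylov-init : ∀ i → krylov k i ≡ krylov (suc k) (Fin.inject₁ i)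
    krylov-init i = cong (Xpow X b) (sym (FinP.toℕ-inject₁ i))

    scaled-init : ∀ i → scaled k k≤n w i ≡ scaled (suc k) t≤n w′ (Fin.inject₁ i)
    scaled-init i = trans (scaledAt-cong {w} {w′} _ (sym (agree _ (toℕ-inject≤< i k≤n))))
                          (cong (scaledAt w′) (inject≤-toℕ-cong k≤n t≤n (sym (FinP.toℕ-inject₁ i))))

    last≡κ : inject≤ (Fin.fromℕ k) t≤n ≡ κ
    last≡κ = FinP.toℕ-injective (trans (FinP.toℕ-inject≤ (Fin.fromℕ k) t≤n) (FinP.toℕ-fromℕ k))

    K≡′ : ∀ r → krylov (suc k) (Fin.fromℕ k) r ≡
                lincomb c (krylov (suc k) ∘ Fin.inject₁) r + scaled (suc k) t≤n w′ (Fin.fromℕ k) r [mod Q ]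
    K≡′ r = subst₂ (λ x y → x r ≡ lincomb c (krylov (suc k) ∘ Fin.inject₁) r + y r [mod Q ])
      (cong (Xpow X b) (sym (FinP.toℕ-fromℕ k)))
      (cong (scaledAt w′) (sym last≡κ))
      (≡mod-trans (K≡ r) (≡mod-reflexive (cong (_+ scaledAt w′ κ r)
        (sumFin-cong k (λ i → cong (λ x → c i * x r) (krylov-init i))))))

  lower-∈span : ∀ {v} (κ : Fin n) → Adapted (toℕ κ) v → (a : Fin (toℕ κ) → ℤ) →
    (+ (p ^ Λ κ)) ⋆ lincomb a (λ i → v (inject≤ i (FinP.toℕ≤n κ))) ∈span krylov (toℕ κ) [mod Q ]
  lower-∈span {v} κ adapted a =
    ∈span-trans (proj₂ (adapted k k≤n ℕP.≤-refl))
      (∈span-resp-≡mod (λ r → ≡mod-reflexive (redistribute r)) (lincomb-∈span a′ (scaled k k≤n v)))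
    where
    k = toℕ κ
    k≤n = FinP.toℕ≤n κ
    ι : Fin k → Fin n
    ι i = inject≤ i k≤n
    Λι≤Λκ : ∀ i → Λ (ι i) ≤ Λ κ
    Λι≤Λκ i = Λ-mono (ℕP.<⇒≤ (toℕ-inject≤< i k≤n))
    a′ : Fin k → ℤ
    a′ i = a i * + (p ^ (Λ κ ∸ Λ (ι i)))
    redistribute : ∀ r → + (p ^ Λ κ) * lincomb a (v ∘ ι) r ≡ lincomb a′ (scaled k k≤n v) r
    redistribute r = trans (*-distribˡ-sumFin k (+ (p ^ Λ κ)) (λ i → a i * v (ι i) r)) (sumFin-cong k λ i →
      trans (cong (_* (a i * v (ι i) r)) (pos-^-split p (Λι≤Λκ i))) (regroup (a i) _ _ (v (ι i) r)))
      where
      regroup : ∀ a q q′ x → (q * q′) * (a * x) ≡ (a * q) * (q′ * x)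
      regroup = solve-∀

  saturated-step : ∀ (κ : Fin n) → State (toℕ κ) → m ≤ Λ κ → (c : Fin (toℕ κ) → ℤ) (e : Vecℤ n) →
    (∀ r → Xpow X b (toℕ κ) r ≡ lincomb c (krylov (toℕ κ)) r + + (p ^ Λ κ) * e r) →
    State (suc (toℕ κ))
  saturated-step κ st m≤Λκ c e K≡ =
    record { w = w ; φ = φ ; basis = basis ; adapted = extend {w′ = w} κ adapted (λ _ _ → refl) c K≡′ }
    where
    open State st
    pᴸ≡0 : ∀ x → + (p ^ Λ κ) * x ≡ + 0 [mod Q ]
    pᴸ≡0 x = ≡mod-trans (≡mod-reflexive (trans (cong (_* x) (pos-^-split p m≤Λκ)) (regroup q Q x)))
                        (multiple-≡mod-0 (q * x))
      where
      q = + (p ^ (Λ κ ∸ m))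
      regroup : ∀ q Q x → (q * Q) * x ≡ (q * x) * Q
      regroup = solve-∀
    K≡′ : ∀ r → Xpow X b (toℕ κ) r ≡ lincomb c (krylov (toℕ κ)) r + scaledAt w κ r [mod Q ]
    K≡′ r = ≡mod-trans (≡mod-reflexive (K≡ r))
      (+-congˡ-≡mod (lincomb c (krylov (toℕ κ)) r) (≡mod-trans (pᴸ≡0 (e r)) (≡mod-sym (pᴸ≡0 (w κ r)))))

  module Unsaturated (κ : Fin n) (st : State (toℕ κ)) (Λκ<m : Λ κ < m)
    (c : Fin (toℕ κ) → ℤ) (e : Vecℤ n)
    (K≡ : ∀ r → Xpow X b (toℕ κ) r ≡ lincomb c (krylov (toℕ κ)) r + + (p ^ Λ κ) * e r)
    (maximal : ∀ j → UPred p X b (toℕ κ) j → j ≤ Λ κ) where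

    open State st

    k = toℕ κ
    pᴸ = + (p ^ Λ κ)

    ι : Fin k → Fin n
    ι i = inject≤ i (FinP.toℕ≤n κ)

    projection : Vecℤ n
    projection = lincomb (λ i → ⟨ φ (ι i) , e ⟩) (w ∘ ι)

    residual : Vecℤ n
    residual r = e r - projection r

    residual-lower-coordinates : ∀ i → ⟨ φ (ι i) , residual ⟩ ≡ + 0 [mod + p ]
    residual-lower-coordinates =
      residual-coordinate {u = w ∘ ι} {ψ = φ ∘ ι}
        (IsDual-∘ {w = w} {φ} {ι} (λ {i} {j} → FinP.inject≤-injective _ _ i j) (isDual basis)) e

    residual-congruence : ∃ λ c′ → ∀ r → Xpow X b k r ≡ lincomb c′ (krylov k) r + pᴸ * residual r [mod Q ]
    residual-congruence = (λ i → c i + d i) , λ r → begin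
      Xpow X b k r                                                   ≡⟨ K≡ r ⟩
      lincomb c (krylov k) r + pᴸ * e r
        ≡⟨ split (lincomb c (krylov k) r) pᴸ (e r) (projection r) ⟩
      lincomb c (krylov k) r + pᴸ * projection r + pᴸ * residual r
        ≈⟨ +-congʳ-≡mod (pᴸ * residual r) (+-congˡ-≡mod (lincomb c (krylov k) r) (pᴸprojection≡ r)) ⟩
      lincomb c (krylov k) r + lincomb d (krylov k) r + pᴸ * residual r
        ≡⟨ cong (_+ pᴸ * residual r) (⟨⟩-+ˡ c d _) ⟨
      lincomb (λ i → c i + d i) (krylov k) r + pᴸ * residual r ∎
      where
      open ≡mod-Reasoning Q
      open _∈span_[mod_] (lower-∈span {v = w} κ adapted (λ i → ⟨ φ (ι i) , e ⟩))
        renaming (coeffs to d; ≡lincomb to pᴸprojection≡)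
      split : ∀ l P x y → l + P * x ≡ l + P * y + P * (x - y)
      split = solve-∀

    residual-≢0 : ¬ (∀ s → + p ℤ∣.∣ ⟨ φ s , residual ⟩)
    residual-≢0 p∣coordinates = ℕP.1+n≰n (maximal (suc (Λ κ)) (UPred-from-≡mod Λκ<m c′ f K≡pᴸ⁺¹))
      where
      c′ = proj₁ residual-congruence
      p∣residual : ∀ r → + p ℤ∣.∣ residual r
      p∣residual r = ≡mod-0⇒∣ (coordinates-≡0⇒≡0 basis (λ s → ∣⇒≡mod-0 (p∣coordinates s)) r)
      f : Vecℤ n
      f r = ℤ∣.quotient (p∣residual r)
      K≡pᴸ⁺¹ : ∀ r → Xpow X b k r ≡ lincomb c′ (krylov k) r + + (p ^ suc (Λ κ)) * f r [mod Q ]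
      K≡pᴸ⁺¹ r = ≡mod-trans (proj₂ residual-congruence r)
        (≡mod-reflexive (cong (_+_ (lincomb c′ (krylov k) r)) pᴸresidual≡))
        where
        open ≡-Reasoning
        regroup : ∀ P x q → P * (x * q) ≡ (q * P) * x
        regroup = solve-∀
        pᴸresidual≡ : pᴸ * residual r ≡ + (p ^ suc (Λ κ)) * f r
        pᴸresidual≡ = begin
          pᴸ * residual r          ≡⟨ cong (pᴸ *_) (ℤ∣._∣_.equality (p∣residual r)) ⟩
          pᴸ * (f r * + p)         ≡⟨ regroup pᴸ (f r) (+ p) ⟩
          (+ p * pᴸ) * f r         ≡⟨ cong (_* f r) (ℤP.pos-* p (p ^ Λ κ)) ⟨
          + (p ^ suc (Λ κ)) * f r  ∎

    unit-coordinate : ∃ λ s → ¬ (+ p ℤ∣.∣ ⟨ φ s , residual ⟩)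
    unit-coordinate = FinP.¬∀⟶∃¬ n _ (λ s → + p ℤ∣.∣? ⟨ φ s , residual ⟩) residual-≢0

    unit-not-below : ∀ j → toℕ j < k → j ≢ proj₁ unit-coordinate
    unit-not-below j j<k refl = proj₂ unit-coordinate (≡mod-0⇒∣
      (subst (λ x → ⟨ φ x , residual ⟩ ≡ + 0 [mod + p ]) ι-fromℕ< (residual-lower-coordinates (fromℕ< j<k))))
      where
      ι-fromℕ< : ι (fromℕ< j<k) ≡ j
      ι-fromℕ< = FinP.toℕ-injective (trans (FinP.toℕ-inject≤ _ _) (FinP.toℕ-fromℕ< j<k))

    next : State (suc k)
    next = exchanged (exchange {w = w} {φ} basis {s} κ residual {proj₁ α-inverse} (proj₂ α-inverse))
      where
      s = proj₁ unit-coordinate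
      α-inverse = inverse-mod-prime p-prime ⟨ φ s , residual ⟩ (proj₂ unit-coordinate)
      c′ = proj₁ residual-congruence

      exchanged : (∃₂ λ w′ φ′ → IsDualBasis (+ p) w′ φ′ × w′ κ ≡ residual ×
                                (∀ j → j ≢ s → j ≢ κ → w′ j ≡ w j)) →
                  State (suc k)
      exchanged (w′ , φ′ , basis′ , w′κ≡residual , w′-agree) =
        record { w = w′ ; φ = φ′ ; basis = basis′ ; adapted = extend {w = w} {w′} κ adapted agree c′ K≡′ }
        where
        agree : ∀ j → toℕ j < k → w′ j ≡ w j
        agree j j<k = w′-agree j (unit-not-below j j<k) (λ j≡κ → ℕP.<-irrefl (cong toℕ j≡κ) j<k)

        K≡′ : ∀ r → Xpow X b k r ≡ lincomb c′ (krylov k) r + scaledAt w′ κ r [mod Q ]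
        K≡′ r = subst (λ v → Xpow X b k r ≡ lincomb c′ (krylov k) r + pᴸ * v r [mod Q ])
                      (sym w′κ≡residual) (proj₂ residual-congruence r)

  step : ∀ κ → State (toℕ κ) → State (suc (toℕ κ))
  step κ st with Λ-minSup κ | m ℕP.≤? Λ κ
  ... | _ , (c , e , K≡) , _       | yes m≤Λκ = saturated-step κ st m≤Λκ c e K≡
  ... | _ , (c , e , K≡) , maximal | no m≰Λκ  =
    Unsaturated.next κ st Λκ<m c e K≡ (maximal Λκ<m)
    where Λκ<m = ℕP.≰⇒> m≰Λκ

  build : ∀ k → k ≤ n → State k
  build zero    _   = initial
  build (suc k) k<n = subst State (cong suc (FinP.toℕ-fromℕ< k<n))
    (step (fromℕ< k<n) (subst State (sym (FinP.toℕ-fromℕ< k<n)) (build k (ℕP.<⇒≤ k<n))))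

lemma2p1 : (p m n : ℕ) → Prime p → 1 ≤ m → 1 ≤ n →
    (X : Matℤ n) (b : Vecℤ n) → ¬ (∀ r → (+ p) ∣ b r) →
    (Λ : Fin n → ℕ) → (∀ k → IsMinSupM (UPred p X b (toℕ k)) m (Λ k)) →
    ∃ λ (v : Fin n → Vecℤ n) → ∀ (t : ℕ) (t≤n : t ≤ n) →
      FullColumnRankModp p (λ (i : Fin t) → v (inject≤ i t≤n))
      × SpanEqMod (+ (p ^ m))
          (λ (i : Fin t) → Xpow X b (toℕ i))
          (λ (i : Fin t) → (+ (p ^ Λ (inject≤ i t≤n))) ⋆ v (inject≤ i t≤n))
lemma2p1 p m n p-prime _ _ X b _ Λ Λ-minSup = w , λ t t≤n →
  prefix-independent t≤n , uncurry ⊆span⇒SpanEqMod (adapted t t≤n t≤n)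
  where
  open Construction p-prime m X b Λ Λ-minSup
  open State (build n ℕP.≤-refl)

  prefix-independent : ∀ {t} (t≤n : t ≤ n) → FullColumnRankModp p (λ i → w (inject≤ i t≤n))
  prefix-independent {t} t≤n = dual⇒independent {w = w ∘ ι} {φ ∘ ι}
    (IsDual-∘ {w = w} {φ} {ι} (λ {i} {j} → FinP.inject≤-injective t≤n t≤n i j) (isDual basis))
    where
    ι : Fin t → Fin n
    ι i = inject≤ i t≤n
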